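{- With the biased estimator, the total variance of the Laplace noise added in Step 2, $\mathrm{Var}\big[\sum_{v\in V}L_v\big]$ where $L_v\sim\mathrm{Lap}(GS(f'_v)/\varepsilon_2)$ are independent, is $O\!\left(\frac{d_{\max}m}{\varepsilon_2^2}\right)$.
   Context: Let $G=(V,E,w)$ be a finite simple undirected graph with $m=|E|$ and maximum degree $d_{\max}$, integer weights, $\Delta$ its triangles, $\rho:\Delta\to V$ with $\rho(T)\in T$, $\Delta_v=\rho^{ -1}(v)$, $\lambda\in\mathbb{Z}$, $\varepsilon_2>0$. For each $\{v,u,x\}\in\Delta_v$ a fixed integer $w'_{ux}$ is given, and $f'_v(w^v)=\sum_{T=\{v,u,x\}\in\Delta_v}\mathbf 1\{w_{vu}+w_{vx}+w'_{ux}<\lambda\}$ is viewed as a function of $w^v=(w_{vu})_{u\in\mathcal N(v)}\in\mathbb{Z}^{d_v}$. $GS(f'_v)=\max\{|f'_v(a)-f'_v(b)|:a,b\in\mathbb{Z}^{d_v},\ \|a-b\|_1\le1\}$. $\mathrm{Lap}(b)$ has density $\frac1{2b}e^{ -|y|/b}$.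
   Formalization: The parameter $\varepsilon_2$ ranges over the positive rationals. -}

module Defs where

open import Data.Bool using (Bool; true; false; T; _∧_; if_then_else_)
open import Data.Nat as ℕ using (ℕ; _⊔_)
open import Data.Fin using (Fin; toℕ)
open import Data.Nat.ListAction using (sum)
open import Data.List using (List; map; allFin; foldr)
open import Data.Integer as ℤ using (ℤ; ∣_∣; _-_; _<?_)
open import Data.Sum using (_⊎_)
open import Data.Fin using (_≟_)
open import Data.Product using (Σ; _×_; ∃)
open import Relation.Binary.PropositionalEquality using (_≡_)
open import Relation.Nullary.Decidable using (⌊_⌋)
open import Data.Rational as ℚ using (ℚ; Positive; _÷_)
open import Data.Rational.Properties using (pos⇒nonZero)

Σ[_]_ : (n : ℕ) → (Fin n → ℕ) → ℕ
Σ[ n ] f = sum (map f (allFin n))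

Max[_]_ : (n : ℕ) → (Fin n → ℕ) → ℕ
Max[ n ] f = foldr _⊔_ 0 (map f (allFin n))

ind : Bool → ℕ
ind true  = 1
ind false = 0

record Graph (n : ℕ) : Set where
  field
    adj   : Fin n → Fin n → Bool
    sym   : ∀ u v → adj u v ≡ adj v u
    irr   : ∀ v → adj v v ≡ false

module _ {n : ℕ} (G : Graph n) where
  open Graph G

  degree : Fin n → ℕ
  degree v = Σ[ n ] (λ u → ind (adj v u))

  dmax : ℕ
  dmax = Max[ n ] degree

  edges : ℕ
  edges = Σ[ n ] (λ u → Σ[ n ] (λ v → ind (⌊ toℕ u ℕ.<? toℕ v ⌋ ∧ adj u v)))

  isTri : Fin n → Fin n → Fin n → Bool
  isTri a b c = adj a b ∧ adj b c ∧ adj a c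

  -- A triangle-assignment ρ : Δ → V with ρ(T) ∈ T, given as a function on
  -- vertex triples, invariant under permuting the triple.
  record Assignment : Set where
    field
      ρ      : Fin n → Fin n → Fin n → Fin n
      ρ-mem  : ∀ a b c → T (isTri a b c) → (ρ a b c ≡ a) ⊎ (ρ a b c ≡ b) ⊎ (ρ a b c ≡ c)
      ρ-swap₁ : ∀ a b c → ρ a b c ≡ ρ b a c
      ρ-swap₂ : ∀ a b c → ρ a b c ≡ ρ a c b

  ownedBy : Assignment → Fin n → Fin n → Fin n → Bool
  ownedBy A v u x = ⌊ Assignment.ρ A v u x ≟ v ⌋

  -- f'_v(w^v) = Σ_{ {v,u,x} ∈ Δ_v } 1{ w_vu + w_vx + w'_ux < λ }.
  -- w^v ∈ ℤ^{N(v)} is represented by a function Fin n → ℤ whose values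
  -- at non-neighbours of v are ignored; each unordered pair {u,x} is
  -- counted once (toℕ u < toℕ x).  The fixed weights w'_ux may depend on
  -- (v,u,x).
  f' : Assignment → (w' : Fin n → Fin n → Fin n → ℤ) → (λ' : ℤ) →
       Fin n → (Fin n → ℤ) → ℕ
  f' A w' λ' v wv =
    Σ[ n ] (λ u → Σ[ n ] (λ x →
      ind (⌊ toℕ u ℕ.<? toℕ x ⌋ ∧ isTri v u x ∧ ownedBy A v u x
           ∧ ⌊ (wv u ℤ.+ wv x ℤ.+ w' v u x) <? λ' ⌋)))

  dist₁ : Fin n → (Fin n → ℤ) → (Fin n → ℤ) → ℕ
  dist₁ v a b = Σ[ n ] (λ u → if adj v u then ∣ a u - b u ∣ else 0)

  IsGS : Assignment → (Fin n → Fin n → Fin n → ℤ) → ℤ → Fin n → ℕ → Set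
  IsGS A w' λ' v g =
    (∀ a b → dist₁ v a b ℕ.≤ 1 →
       ∣ ℤ.+ (f' A w' λ' v a) - ℤ.+ (f' A w' λ' v b) ∣ ℕ.≤ g)
    × (Σ (Fin n → ℤ) λ a → Σ (Fin n → ℤ) λ b →
         dist₁ v a b ℕ.≤ 1
         × ∣ ℤ.+ (f' A w' λ' v a) - ℤ.+ (f' A w' λ' v b) ∣ ≡ g)

-- Variance of Lap(b): 2 b².
lapVar : ℚ → ℚ
lapVar b = (ℤ.+ 2 ℚ./ 1) ℚ.* b ℚ.* b

-- Var[Σ_v L_v] for independent L_v ~ Lap(gs v / ε) = Σ_v Var[L_v].
totalNoiseVar : (n : ℕ) → (gs : Fin n → ℕ) → (ε : ℚ) → .{{Positive ε}} → ℚ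
totalNoiseVar n gs ε = foldr ℚ._+_ ℚ.0ℚ
  (map (λ v → lapVar (((ℤ.+ (gs v) ℚ./ 1) ÷ ε) {{pos⇒nonZero ε}})) (allFin n))

{-# OPTIONS --safe #-}
-- Changing w^v by one in the coordinate w_vu can only flip the indicators of the triangles
-- {v,u,x} ∈ Δ_v through the edge vu, and there are fewer than d_v of those; the cruder
-- GS(f'_v) ≤ 2 d_v suffices.  As Var Lap(b) = 2b², the total variance
-- is Σ_v 2 GS(f'_v)² / ε² ≤ 8 Σ_v d_v² / ε² ≤ 8 d_max Σ_v d_v / ε² = 16 d_max m / ε²,
-- the last step being the handshake lemma Σ_v d_v = 2m.
module Submission where

open import Defs
open import Data.Nat using (ℕ; _*_)
open import Data.Fin using (Fin)
open import Data.Integer using (ℤ; +_)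
open import Data.Product using (∃)
open import Data.Rational using (ℚ; Positive; _≤_; _/_; _÷_)
open import Data.Rational.Properties using (pos⇒nonZero)

import Data.Nat.Properties as ℕ
open import Algebra.Properties.Semiring.Sum ℕ.+-*-semiring
  using (sum-syntax; ∑-distrib-+; ∑-comm; *-distribˡ-sum; *-distribʳ-sum)
open import Data.Bool using (Bool; true; false; T; _∧_; if_then_else_)
open import Data.Bool.Properties using (T-∧)
open import Data.Fin using (zero; suc; toℕ)
import Data.Fin.Properties as Fin
open import Data.Integer as ℤ using (∣_∣; _-_)
import Data.Integer.Properties as ℤ
open import Data.List using ([]; _∷_; map; foldr; allFin; tabulate)
open import Data.List.Properties using (map-cong; map-tabulate)
open import Data.List.Membership.Propositional using (_∈_)
open import Data.List.Membership.Propositional.Properties using (∈-map⁺; ∈-allFin)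
open import Data.List.Relation.Unary.Any using (here; there)
open import Data.Nat as ℕ using (_+_; _⊔_; z≤n)
open import Data.Nat.ListAction using (sum)
open import Data.Nat.Properties
  using (+-identityʳ; *-identityˡ; *-identityʳ; ≤-trans; ≤-reflexive; ≤-total;
         +-mono-≤; +-monoʳ-≤; *-monoˡ-≤; *-monoʳ-≤; *-mono-≤; m≤m+n; m≤n+m; m≤m⊔n;
         m≤n⇒m≤o⊔n; m≤n+o⇒m∸n≤o; n≢0⇒n>0; module ≤-Reasoning)
open import Data.Nat.Solver using (module +-*-Solver)
import Data.Nat.Coprimality as Coprimality
import Data.Rational as ℚ
import Data.Rational.Properties as ℚ
import Data.Rational.Solver as ℚ-Solver
open import Data.Product using (_,_; proj₂)
open import Data.Sum using (_⊎_; inj₁; inj₂)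
open import Function using (_∘_; id; Equivalence)
open import Relation.Binary.PropositionalEquality
open import Relation.Nullary using (yes; no; contradiction)
open import Relation.Nullary.Decidable using (⌊_⌋)

private variable
  m n : ℕ

m+m≡2*m : ∀ m → m + m ≡ 2 * m
m+m≡2*m m = cong (_+_ m) (sym (+-identityʳ m))

Σ≡∑ : (f : Fin n → ℕ) → Σ[ n ] f ≡ ∑[ i < n ] f i
Σ≡∑ {n} f = trans (cong sum (map-tabulate id f)) (sum-tabulate f)
  where
  sum-tabulate : ∀ {n} (g : Fin n → ℕ) → sum (tabulate g) ≡ ∑[ i < n ] g i
  sum-tabulate {ℕ.zero}  g = refl
  sum-tabulate {ℕ.suc n} g = cong (_+_ (g zero)) (sum-tabulate (g ∘ suc))

Σ-cong : {f g : Fin n → ℕ} → (∀ i → f i ≡ g i) → Σ[ n ] f ≡ Σ[ n ] g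
Σ-cong {n} f≗g = cong sum (map-cong f≗g (allFin n))

Σ-distrib-+ : (f g : Fin n → ℕ) → Σ[ n ] (λ i → f i + g i) ≡ Σ[ n ] f + Σ[ n ] g
Σ-distrib-+ f g rewrite Σ≡∑ (λ i → f i + g i) | Σ≡∑ f | Σ≡∑ g = ∑-distrib-+ f g

*-distribˡ-Σ : ∀ k (f : Fin n → ℕ) → k * Σ[ n ] f ≡ Σ[ n ] (λ i → k * f i)
*-distribˡ-Σ k f rewrite Σ≡∑ f | Σ≡∑ (λ i → k * f i) = *-distribˡ-sum k f

*-distribʳ-Σ : ∀ k (f : Fin n → ℕ) → Σ[ n ] f * k ≡ Σ[ n ] (λ i → f i * k)
*-distribʳ-Σ k f rewrite Σ≡∑ f | Σ≡∑ (λ i → f i * k) = *-distribʳ-sum k f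

Σ-comm : (f : Fin m → Fin n → ℕ) →
         Σ[ m ] (λ i → Σ[ n ] (f i)) ≡ Σ[ n ] (λ j → Σ[ m ] (λ i → f i j))
Σ-comm {m} {n} f = begin
  Σ[ m ] (λ i → Σ[ n ] (f i))            ≡⟨ Σ-cong (λ i → Σ≡∑ (f i)) ⟩
  Σ[ m ] (λ i → ∑[ j < n ] f i j)        ≡⟨ Σ≡∑ (λ i → ∑[ j < n ] f i j) ⟩
  ∑[ i < m ] ∑[ j < n ] f i j            ≡⟨ ∑-comm f ⟩
  ∑[ j < n ] ∑[ i < m ] f i j            ≡⟨ Σ≡∑ (λ j → ∑[ i < m ] f i j) ⟨
  Σ[ n ] (λ j → ∑[ i < m ] f i j)        ≡⟨ Σ-cong (λ j → Σ≡∑ (λ i → f i j)) ⟨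
  Σ[ n ] (λ j → Σ[ m ] (λ i → f i j))    ∎
  where open ≡-Reasoning

Σ-mono-≤ : {f g : Fin n → ℕ} → (∀ i → f i ℕ.≤ g i) → Σ[ n ] f ℕ.≤ Σ[ n ] g
Σ-mono-≤ {n} {f} {g} f≤g = sum-mono (allFin n)
  where
  sum-mono : ∀ is → sum (map f is) ℕ.≤ sum (map g is)
  sum-mono []       = z≤n
  sum-mono (i ∷ is) = +-mono-≤ (f≤g i) (sum-mono is)

Σ-≤-+ : {f g h : Fin n → ℕ} → (∀ i → f i ℕ.≤ g i + h i) → Σ[ n ] f ℕ.≤ Σ[ n ] g + Σ[ n ] h
Σ-≤-+ {g = g} {h} f≤g+h = ≤-trans (Σ-mono-≤ f≤g+h) (≤-reflexive (Σ-distrib-+ g h))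

Σ-Σ-symmetrised-* : (f g : Fin n → ℕ) →
  Σ[ n ] (λ i → Σ[ n ] (λ j → f i * g j + f j * g i)) ≡ 2 * (Σ[ n ] f * Σ[ n ] g)
Σ-Σ-symmetrised-* {n} f g = begin
  Σ[ n ] (λ i → Σ[ n ] (λ j → f i * g j + f j * g i))
    ≡⟨ Σ-cong (λ i → Σ-distrib-+ (λ j → f i * g j) (λ j → f j * g i)) ⟩
  Σ[ n ] (λ i → Σ[ n ] (λ j → f i * g j) + Σ[ n ] (λ j → f j * g i))
    ≡⟨ Σ-cong (λ i → cong₂ _+_ (*-distribˡ-Σ (f i) g) (*-distribʳ-Σ (g i) f)) ⟨
  Σ[ n ] (λ i → f i * Σ[ n ] g + Σ[ n ] f * g i)
    ≡⟨ Σ-distrib-+ (λ i → f i * Σ[ n ] g) (λ i → Σ[ n ] f * g i) ⟩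
  Σ[ n ] (λ i → f i * Σ[ n ] g) + Σ[ n ] (λ i → Σ[ n ] f * g i)
    ≡⟨ cong₂ _+_ (*-distribʳ-Σ (Σ[ n ] g) f) (*-distribˡ-Σ (Σ[ n ] f) g) ⟨
  Σ[ n ] f * Σ[ n ] g + Σ[ n ] f * Σ[ n ] g
    ≡⟨ m+m≡2*m (Σ[ n ] f * Σ[ n ] g) ⟩
  2 * (Σ[ n ] f * Σ[ n ] g)
    ∎
  where open ≡-Reasoning

∈⇒≤foldr-⊔ : ∀ {k ks} → k ∈ ks → k ℕ.≤ foldr _⊔_ 0 ks
∈⇒≤foldr-⊔ {k} (here refl) = m≤m⊔n k _
∈⇒≤foldr-⊔ {ks = l ∷ _} (there k∈ks) = m≤n⇒m≤o⊔n l (∈⇒≤foldr-⊔ k∈ks)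

≤-Max : (f : Fin n → ℕ) (i : Fin n) → f i ℕ.≤ Max[ n ] f
≤-Max f i = ∈⇒≤foldr-⊔ (∈-map⁺ f (∈-allFin i))

Σ-square-≤ : (f : Fin n → ℕ) → Σ[ n ] (λ i → f i * f i) ℕ.≤ Max[ n ] f * Σ[ n ] f
Σ-square-≤ f = ≤-trans (Σ-mono-≤ (λ i → *-monoˡ-≤ (f i) (≤-Max f i)))
                       (≤-reflexive (sym (*-distribˡ-Σ (Max[ _ ] f) f)))

ind-T : ∀ {c} → T c → ind c ≡ 1
ind-T {true} _ = refl

if-T : ∀ {A : Set} {c} {x y : A} → T c → (if c then x else y) ≡ x
if-T {c = true} _ = refl

ind-≤-+ : ∀ {c c′ k} → (c ≢ c′ → 1 ℕ.≤ k) → ind c ℕ.≤ ind c′ + k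
ind-≤-+ {false} _ = z≤n
ind-≤-+ {true} {true} _ = m≤m+n 1 _
ind-≤-+ {true} {false} c≢c′ = c≢c′ (λ ())

ind-∧-≤ : ∀ b {c c′ k} → (T b → ind c ℕ.≤ ind c′ + k) → ind (b ∧ c) ℕ.≤ ind (b ∧ c′) + k
ind-∧-≤ false _ = z≤n
ind-∧-≤ true c≤c′+k = c≤c′+k _

0<∣i-j∣ : ∀ {i j} → i ≢ j → 0 ℕ.< ∣ i - j ∣
0<∣i-j∣ {i} {j} i≢j = n≢0⇒n>0 (i≢j ∘ ℤ.i-j≡0⇒i≡j i j ∘ ℤ.∣i∣≡0⇒i≡0)

m≤n+o⇒n≤m+o⇒∣m-n∣≤o : ∀ {m n o} → m ℕ.≤ n + o → n ℕ.≤ m + o → ∣ + m - + n ∣ ℕ.≤ o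
m≤n+o⇒n≤m+o⇒∣m-n∣≤o {m} {n} m≤n+o n≤m+o rewrite ℤ.m-n≡m⊖n m n with ≤-total m n
... | inj₁ m≤n rewrite ℤ.∣⊖∣-≤ m≤n = m≤n+o⇒m∸n≤o n m n≤m+o
... | inj₂ n≤m rewrite ℤ.∣m⊖n∣≡∣n⊖m∣ m n | ℤ.∣⊖∣-≤ n≤m = m≤n+o⇒m∸n≤o m n m≤n+o

module _ (G : Graph n) where
  open Graph G using (adj; irr) renaming (sym to adj-sym)

  ascendingEdge : Fin n → Fin n → ℕ
  ascendingEdge u v = ind (⌊ toℕ u ℕ.<? toℕ v ⌋ ∧ adj u v)

  ind-adj≡ascending+descending : ∀ u v → ind (adj u v) ≡ ascendingEdge u v + ascendingEdge v u
  ind-adj≡ascending+descending u v with toℕ u ℕ.<? toℕ v | toℕ v ℕ.<? toℕ u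
  ... | yes u<v | yes v<u = contradiction v<u (ℕ.<⇒≯ u<v)
  ... | yes _   | no _    = sym (+-identityʳ _)
  ... | no _    | yes _   = cong ind (adj-sym u v)
  ... | no u≮v  | no v≮u  = begin
    ind (adj u v)  ≡⟨ cong (ind ∘ adj u) u≡v ⟨
    ind (adj u u)  ≡⟨ cong ind (irr u) ⟩
    0              ∎
    where
    open ≡-Reasoning
    u≡v : u ≡ v
    u≡v = Fin.toℕ-injective (ℕ.≤-antisym (ℕ.≮⇒≥ v≮u) (ℕ.≮⇒≥ u≮v))

  handshake : Σ[ n ] (degree G) ≡ 2 * edges G
  handshake = begin
    Σ[ n ] (degree G)
      ≡⟨ Σ-cong (λ u → Σ-cong (ind-adj≡ascending+descending u)) ⟩
    Σ[ n ] (λ u → Σ[ n ] (λ v → ascendingEdge u v + ascendingEdge v u))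
      ≡⟨ Σ-cong (λ u → Σ-distrib-+ (ascendingEdge u) (λ v → ascendingEdge v u)) ⟩
    Σ[ n ] (λ u → Σ[ n ] (ascendingEdge u) + Σ[ n ] (λ v → ascendingEdge v u))
      ≡⟨ Σ-distrib-+ (λ u → Σ[ n ] (ascendingEdge u)) (λ u → Σ[ n ] (λ v → ascendingEdge v u)) ⟩
    edges G + Σ[ n ] (λ u → Σ[ n ] (λ v → ascendingEdge v u))
      ≡⟨ cong (_+_ (edges G)) (Σ-comm ascendingEdge) ⟨
    edges G + edges G
      ≡⟨ m+m≡2*m (edges G) ⟩
    2 * edges G
      ∎
    where open ≡-Reasoning

  Σ-degree²-≤ : Σ[ n ] (λ v → degree G v * degree G v) ℕ.≤ dmax G * (2 * edges G)
  Σ-degree²-≤ = ≤-trans (Σ-square-≤ (degree G)) (≤-reflexive (cong (dmax G *_) handshake))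

  dist₁-sym : ∀ v a b → dist₁ G v a b ≡ dist₁ G v b a
  dist₁-sym v a b = Σ-cong (λ u → cong (λ k → if adj v u then k else 0) (ℤ.∣i-j∣≡∣j-i∣ (a u) (b u)))

module _ (G : Graph n) (A : Assignment G) (w' : Fin n → Fin n → Fin n → ℤ) (λ' : ℤ) (v : Fin n) where
  open Graph G using (adj)

  below : (Fin n → ℤ) → Fin n → Fin n → Bool
  below w u x = ⌊ w u ℤ.+ w x ℤ.+ w' v u x ℤ.<? λ' ⌋

  counted : (Fin n → ℤ) → Fin n → Fin n → ℕ
  counted w u x = ind (⌊ toℕ u ℕ.<? toℕ x ⌋ ∧ isTri G v u x ∧ ownedBy G A v u x ∧ below w u x)

  module _ (a b : Fin n → ℤ) where
    change : Fin n → ℕ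
    change u = if adj v u then ∣ a u - b u ∣ else 0

    below-changed : ∀ {u x} → below a u x ≢ below b u x → a u ≢ b u ⊎ a x ≢ b x
    below-changed {u} {x} below≢ with a u ℤ.≟ b u | a x ℤ.≟ b x
    ... | no au≢bu | _        = inj₁ au≢bu
    ... | yes _    | no ax≢bx = inj₂ ax≢bx
    ... | yes au≡bu | yes ax≡bx =
      contradiction (cong₂ (λ p q → ⌊ p ℤ.+ q ℤ.+ w' v u x ℤ.<? λ' ⌋) au≡bu ax≡bx) below≢

    1≤change*ind-adj : ∀ {u x} → T (adj v u) → T (adj v x) → a u ≢ b u →
                       1 ℕ.≤ change u * ind (adj v x)
    1≤change*ind-adj {u} {x} vu vx au≢bu = begin
      1                               ≤⟨ 0<∣i-j∣ au≢bu ⟩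
      ∣ a u - b u ∣                   ≡⟨ *-identityʳ _ ⟨
      ∣ a u - b u ∣ * 1               ≡⟨ cong₂ _*_ (if-T vu) (ind-T vx) ⟨
      change u * ind (adj v x)        ∎
      where open ≤-Reasoning

    -- The threshold test of {v,u,x} can only flip if w^v changes on vu or on vx.  The error
    -- term is summed over all ordered pairs (u,x), not only u < x: the crude factor 2 in f'-≤.
    counted-≤ : ∀ u x → counted a u x ℕ.≤
                counted b u x + (change u * ind (adj v x) + change x * ind (adj v u))
    counted-≤ u x =
      ind-∧-≤ ⌊ toℕ u ℕ.<? toℕ x ⌋ λ _ →
      ind-∧-≤ (isTri G v u x) λ tri →
      ind-∧-≤ (ownedBy G A v u x) λ _ →
      ind-≤-+ (flip-costs tri)
      where
      flip-costs : T (isTri G v u x) → below a u x ≢ below b u x →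
                   1 ℕ.≤ change u * ind (adj v x) + change x * ind (adj v u)
      flip-costs tri below≢ with Equivalence.to T-∧ tri
      ... | vu , ux∧vx with proj₂ (Equivalence.to T-∧ ux∧vx) | below-changed below≢
      ...   | vx | inj₁ au≢bu = ≤-trans (1≤change*ind-adj vu vx au≢bu) (m≤m+n _ _)
      ...   | vx | inj₂ ax≢bx = ≤-trans (1≤change*ind-adj vx vu ax≢bx) (m≤n+m _ _)

    f'-≤ : dist₁ G v a b ℕ.≤ 1 → f' G A w' λ' v a ℕ.≤ f' G A w' λ' v b + 2 * degree G v
    f'-≤ d≤1 = begin
      f' G A w' λ' v a
        ≤⟨ Σ-≤-+ (λ u → Σ-≤-+ (counted-≤ u)) ⟩
      fb + Σ[ n ] (λ u → Σ[ n ] (λ x → change u * ind (adj v x) + change x * ind (adj v u)))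
        ≡⟨ cong (_+_ fb) (Σ-Σ-symmetrised-* change (ind ∘ adj v)) ⟩
      fb + 2 * (dist₁ G v a b * degree G v)
        ≤⟨ +-monoʳ-≤ fb (*-monoʳ-≤ 2 (*-monoˡ-≤ (degree G v) d≤1)) ⟩
      fb + 2 * (1 * degree G v)
        ≡⟨ cong (λ k → fb + 2 * k) (*-identityˡ (degree G v)) ⟩
      fb + 2 * degree G v
        ∎
      where
      open ≤-Reasoning
      fb : ℕ
      fb = f' G A w' λ' v b

  GS-≤ : ∀ {g} → IsGS G A w' λ' v g → g ℕ.≤ 2 * degree G v
  GS-≤ (_ , a , b , d≤1 , ∣fa-fb∣≡g) = subst (ℕ._≤ 2 * degree G v) ∣fa-fb∣≡g
    (m≤n+o⇒n≤m+o⇒∣m-n∣≤o (f'-≤ a b d≤1) (f'-≤ b a (subst (ℕ._≤ 1) (dist₁-sym G v a b) d≤1)))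

Σ-2*g*g-≤ : (G : Graph n) (gs : Fin n → ℕ) → (∀ v → gs v ℕ.≤ 2 * degree G v) →
            Σ[ n ] (λ v → 2 * gs v * gs v) ℕ.≤ 16 * dmax G * edges G
Σ-2*g*g-≤ {n} G gs gs≤2d = begin
  Σ[ n ] (λ v → 2 * gs v * gs v)
    ≤⟨ Σ-mono-≤ (λ v → *-mono-≤ (*-monoʳ-≤ 2 (gs≤2d v)) (gs≤2d v)) ⟩
  Σ[ n ] (λ v → 2 * (2 * d v) * (2 * d v))
    ≡⟨ Σ-cong (λ v → 2*[2*d]*[2*d]≡8*[d*d] (d v)) ⟩
  Σ[ n ] (λ v → 8 * (d v * d v))
    ≡⟨ *-distribˡ-Σ 8 (λ v → d v * d v) ⟨
  8 * Σ[ n ] (λ v → d v * d v)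
    ≤⟨ *-monoʳ-≤ 8 (Σ-degree²-≤ G) ⟩
  8 * (dmax G * (2 * edges G))
    ≡⟨ 8*[x*[2*y]]≡16*x*y (dmax G) (edges G) ⟩
  16 * dmax G * edges G
    ∎
  where
  open ≤-Reasoning
  open +-*-Solver using (solve; _:*_; _:=_; con)
  d : Fin n → ℕ
  d = degree G
  2*[2*d]*[2*d]≡8*[d*d] : ∀ x → 2 * (2 * x) * (2 * x) ≡ 8 * (x * x)
  2*[2*d]*[2*d]≡8*[d*d] = solve 1 (λ x → con 2 :* (con 2 :* x) :* (con 2 :* x) := con 8 :* (x :* x)) refl
  8*[x*[2*y]]≡16*x*y : ∀ x y → 8 * (x * (2 * y)) ≡ 16 * x * y
  8*[x*[2*y]]≡16*x*y = solve 2 (λ x y → con 8 :* (x :* (con 2 :* y)) := con 16 :* x :* y) refl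

toℚ : ℕ → ℚ
toℚ k = + k / 1

toℚ≡mkℚ : ∀ k → toℚ k ≡ ℚ.mkℚ (+ k) 0 (Coprimality.sym (Coprimality.1-coprimeTo k))
toℚ≡mkℚ k = ℚ.↥p/↧p≡p (ℚ.mkℚ (+ k) 0 (Coprimality.sym (Coprimality.1-coprimeTo k)))

toℚ-+ : ∀ k l → toℚ k ℚ.+ toℚ l ≡ toℚ (k + l)
toℚ-+ k l rewrite toℚ≡mkℚ k | toℚ≡mkℚ l =
  ℚ./-cong {p₂ = + (k + l)}
    (trans (cong₂ ℤ._+_ (ℤ.*-identityʳ (+ k)) (ℤ.*-identityʳ (+ l))) (sym (ℤ.pos-+ k l))) refl

toℚ-* : ∀ k l → toℚ k ℚ.* toℚ l ≡ toℚ (k * l)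
toℚ-* k l rewrite toℚ≡mkℚ k | toℚ≡mkℚ l = ℚ./-cong {p₂ = + (k * l)} (sym (ℤ.pos-* k l)) refl

toℚ-mono-≤ : ∀ {k l} → k ℕ.≤ l → toℚ k ≤ toℚ l
toℚ-mono-≤ {k} {l} k≤l rewrite toℚ≡mkℚ k | toℚ≡mkℚ l =
  ℚ.*≤* (subst₂ ℤ._≤_ (sym (ℤ.*-identityʳ (+ k))) (sym (ℤ.*-identityʳ (+ l))) (ℤ.+≤+ k≤l))

module _ (ε : ℚ) .{{ε>0 : Positive ε}} where
  private instance
    ε≢0 : ℚ.NonZero ε
    ε≢0 = pos⇒nonZero ε

  private module QS = ℚ-Solver.+-*-Solver

  ÷ε-mono-≤ : ∀ {p q} → p ≤ q → p ÷ ε ≤ q ÷ ε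
  ÷ε-mono-≤ = ℚ.*-monoʳ-≤-nonNeg (ℚ.1/ ε) {{ℚ.pos⇒nonNeg (ℚ.1/ ε) {{ℚ.1/pos⇒pos ε}}}}

  lapVar-toℚ÷ε : ∀ g → lapVar (toℚ g ÷ ε) ≡ toℚ (2 * g * g) ÷ ε ÷ ε
  lapVar-toℚ÷ε g = begin
    toℚ 2 ℚ.* (toℚ g ÷ ε) ℚ.* (toℚ g ÷ ε)
      ≡⟨ QS.solve 3 (λ t x e → t QS.:* (x QS.:* e) QS.:* (x QS.:* e) QS.:= t QS.:* x QS.:* x QS.:* e QS.:* e)
                  refl (toℚ 2) (toℚ g) (ℚ.1/ ε) ⟩
    toℚ 2 ℚ.* toℚ g ℚ.* toℚ g ÷ ε ÷ ε
      ≡⟨ cong (λ p → p ÷ ε ÷ ε) (trans (cong (ℚ._* toℚ g) (toℚ-* 2 g)) (toℚ-* (2 * g) g)) ⟩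
    toℚ (2 * g * g) ÷ ε ÷ ε
      ∎
    where open ≡-Reasoning

  foldr-+-toℚ÷ε÷ε : ∀ {A : Set} (k : A → ℕ) xs →
    foldr ℚ._+_ ℚ.0ℚ (map (λ x → toℚ (k x) ÷ ε ÷ ε) xs) ≡ toℚ (sum (map k xs)) ÷ ε ÷ ε
  foldr-+-toℚ÷ε÷ε k [] = sym (trans (cong (ℚ._* ℚ.1/ ε) (ℚ.*-zeroˡ (ℚ.1/ ε))) (ℚ.*-zeroˡ (ℚ.1/ ε)))
  foldr-+-toℚ÷ε÷ε k (x ∷ xs) = begin
    toℚ (k x) ÷ ε ÷ ε ℚ.+ foldr ℚ._+_ ℚ.0ℚ (map (λ y → toℚ (k y) ÷ ε ÷ ε) xs)
      ≡⟨ cong (toℚ (k x) ÷ ε ÷ ε ℚ.+_) (foldr-+-toℚ÷ε÷ε k xs) ⟩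
    toℚ (k x) ÷ ε ÷ ε ℚ.+ toℚ S ÷ ε ÷ ε
      ≡⟨ QS.solve 3 (λ p q e → p QS.:* e QS.:* e QS.:+ q QS.:* e QS.:* e QS.:= (p QS.:+ q) QS.:* e QS.:* e)
                  refl (toℚ (k x)) (toℚ S) (ℚ.1/ ε) ⟩
    (toℚ (k x) ℚ.+ toℚ S) ÷ ε ÷ ε
      ≡⟨ cong (λ p → p ÷ ε ÷ ε) (toℚ-+ (k x) S) ⟩
    toℚ (k x + S) ÷ ε ÷ ε
      ∎
    where
    open ≡-Reasoning
    S = sum (map k xs)

  totalNoiseVar≡ : (gs : Fin n → ℕ) → totalNoiseVar n gs ε ≡ toℚ (Σ[ n ] (λ v → 2 * gs v * gs v)) ÷ ε ÷ ε
  totalNoiseVar≡ {n} gs =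
    trans (cong (foldr ℚ._+_ ℚ.0ℚ) (map-cong (lapVar-toℚ÷ε ∘ gs) (allFin n)))
          (foldr-+-toℚ÷ε÷ε (λ v → 2 * gs v * gs v) (allFin n))

  totalNoiseVar-≤ : ∀ {N} (gs : Fin n → ℕ) → Σ[ n ] (λ v → 2 * gs v * gs v) ℕ.≤ N →
                    totalNoiseVar n gs ε ≤ toℚ N ÷ ε ÷ ε
  totalNoiseVar-≤ {n} {N} gs Σ≤N = begin
    totalNoiseVar n gs ε                             ≡⟨ totalNoiseVar≡ gs ⟩
    toℚ (Σ[ n ] (λ v → 2 * gs v * gs v)) ÷ ε ÷ ε     ≤⟨ ÷ε-mono-≤ (÷ε-mono-≤ (toℚ-mono-≤ Σ≤N)) ⟩
    toℚ N ÷ ε ÷ ε                                    ∎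
    where open ℚ.≤-Reasoning

mainTheorem18 :
    ∃ λ (C : ℕ) →
      ∀ (n : ℕ) (G : Graph n) (A : Assignment G)
        (w' : Fin n → Fin n → Fin n → ℤ) (λ' : ℤ)
        (ε : ℚ) .{{εpos : Positive ε}} (gs : Fin n → ℕ) →
        (∀ v → IsGS G A w' λ' v (gs v)) →
        totalNoiseVar n gs ε
          ≤ ((((+ (C * dmax G * edges G)) / 1) ÷ ε) {{pos⇒nonZero ε}} ÷ ε) {{pos⇒nonZero ε}}
mainTheorem18 = 16 , λ n G A w' λ' ε gs isGS →
  totalNoiseVar-≤ ε gs (Σ-2*g*g-≤ G gs (λ v → GS-≤ G A w' λ' v (isGS v)))
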